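{- Let $\vec\alpha\,F$ be an $n$-ary BNF and let $\sim$ be a type-polymorphic family of relations on $\vec\alpha\,F$ that is, at every type instance, an equivalence relation, and that is respected by the mapper: $x\sim y$ implies $\mathrm{map}_F\,\vec f\,x\sim\mathrm{map}_F\,\vec f\,y$ for all $\vec f$. If $A_i\neq\emptyset$ for all $i$, then $[F^{\sim}_{\mathrm{in}}\,\vec A]_\sim\subseteq[F_{\mathrm{in}}\,\vec A]_\sim$.
   Context: HOL setting (all types non-empty); vector notation $\vec x=x_1,\dots,x_n$ with synchronized indices. An $n$-ary BNF is a type constructor $\vec\alpha\,F$ with polymorphic mapper $\mathrm{map}_F::(\alpha_1\to\beta_1)\to\cdots\to(\alpha_n\to\beta_n)\to\vec\alpha\,F\to\vec\beta\,F$, setters $\mathrm{set}_{F,i}::\vec\alpha\,F\to\alpha_i\ \mathrm{set}$, infinite cardinal bound $\mathrm{bd}_F$, relator $\mathrm{rel}_F$, satisfying: $\mathrm{map}_F\,\vec{\mathrm{id}}=\mathrm{id}$; $\mathrm{map}_F\,\vec g\circ\mathrm{map}_F\,\vec f=\mathrm{map}_F\,\overrightarrow{(g\circ f)}$; $\mathrm{set}_{F,i}(\mathrm{map}_F\,\vec f\,x)=f_i\langle\mathrm{set}_{F,i}\,x\rangle$ (image); if $f_i z=g_i z$ for all $i$ and $z\in\mathrm{set}_{F,i}\,x$ then $\mathrm{map}_F\,\vec f\,x=\mathrm{map}_F\,\vec g\,x$; $|\mathrm{set}_{F,i}\,x|\le\mathrm{bd}_F$; $(x,y)\in\mathrm{rel}_F\,\vec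 R$ iff some $z$ has $\mathrm{set}_{F,i}\,z\subseteq R_i$ for all $i$, $\mathrm{map}_F\,\overrightarrow{\mathrm{fst}}\,z=x$, $\mathrm{map}_F\,\overrightarrow{\mathrm{snd}}\,z=y$; $\mathrm{rel}_F\,\vec R\bullet\mathrm{rel}_F\,\vec S\subseteq\mathrm{rel}_F\,\overrightarrow{(R\bullet S)}$ ($\bullet$ = relation composition). Notation: $F_{\mathrm{in}}\,\vec A=\{x\mid\forall i.\ \mathrm{set}_{F,i}\,x\subseteq A_i\}$; $[x]_\sim=\{y\mid x\sim y\}$ and $[A]_\sim=\{[x]_\sim\mid x\in A\}$; $\mathsf 1+\alpha$ is the sum of the unit type and $\alpha$, with the new element $\circledast$ (left injection of the unit) and the right injection $\mathfrak e::\alpha\to\mathsf 1+\alpha$. Define $$F^{\sim}_{\mathrm{in}}\,\vec A=\{x\mid\forall\vec f\,\vec g.\ (\forall i.\ \forall a\in A_i.\ f_i\,a=g_i\,a)\longrightarrow\mathrm{map}_F\,\vec f\,x\sim\mathrm{map}_F\,\vec g\,x\},$$ with $f_i,g_i::\alpha_i\to\mathsf 1+\alpha_i$. -}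

module Defs where

open import Data.Nat using (ℕ)
open import Data.Fin using (Fin)
open import Data.Bool using (Bool; true; false)
open import Data.Unit using (⊤; tt)
open import Data.Sum using (_⊎_; inj₁; inj₂)
open import Data.Product using (Σ; ∃; _×_; _,_; proj₁; proj₂)
open import Function using (_∘_; id)
open import Function.Bundles using (_↣_; _⇔_)
open import Relation.Binary.PropositionalEquality using (_≡_)
open import Relation.Binary.Structures using (IsEquivalence)

-- HOL sets over a type: characteristic functions into bool (literally HOL's 'a set).
HSet : Set → Set
HSet α = α → Bool

_∈ₕ_ : {α : Set} → α → HSet α → Set
a ∈ₕ A = A a ≡ true

1+ : Set → Set
1+ α = ⊤ ⊎ α

⊛ : {α : Set} → 1+ α
⊛ = inj₁ tt

𝔢 : {α : Set} → α → 1+ α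
𝔢 = inj₂

record BNF (n : ℕ) : Set₁ where
  field
    F      : (Fin n → Set) → Set
    mapF   : {α β : Fin n → Set} → ((i : Fin n) → α i → β i) → F α → F β
    setF   : {α : Fin n → Set} (i : Fin n) → F α → HSet (α i)
    bd     : Set   -- (a type whose cardinality is) the bound bd_F
    relF   : {α β : Fin n → Set} → ((i : Fin n) → α i → β i → Set) → F α → F β → Set
    map-id : {α : Fin n → Set} (x : F α) → mapF (λ i → id) x ≡ x
    map-comp : {α β γ : Fin n → Set} (f : (i : Fin n) → α i → β i) (g : (i : Fin n) → β i → γ i)
               (x : F α) → mapF g (mapF f x) ≡ mapF (λ i → g i ∘ f i) x
    set-map : {α β : Fin n → Set} (f : (i : Fin n) → α i → β i) (x : F α) (i : Fin n) (b : β i) →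
              (b ∈ₕ setF i (mapF f x)) ⇔ (∃ λ a → (a ∈ₕ setF i x) × (f i a ≡ b))
    map-cong : {α β : Fin n → Set} (f g : (i : Fin n) → α i → β i) (x : F α) →
               ((i : Fin n) (a : α i) → a ∈ₕ setF i x → f i a ≡ g i a) → mapF f x ≡ mapF g x
    bd-infinite : ℕ ↣ bd
    set-bd : {α : Fin n → Set} (x : F α) (i : Fin n) → (Σ (α i) λ a → a ∈ₕ setF i x) ↣ bd
    rel-def : {α β : Fin n → Set} (R : (i : Fin n) → α i → β i → Set) (x : F α) (y : F β) →
              relF R x y ⇔
              (∃ λ (z : F (λ i → α i × β i)) →
                 ((i : Fin n) (p : α i × β i) → p ∈ₕ setF i z → R i (proj₁ p) (proj₂ p))
                 × (mapF (λ i → proj₁) z ≡ x) × (mapF (λ i → proj₂) z ≡ y))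
    rel-comp : {α β γ : Fin n → Set} (R : (i : Fin n) → α i → β i → Set) (S : (i : Fin n) → β i → γ i → Set)
               (x : F α) (y : F β) (z : F γ) → relF R x y → relF S y z →
               relF (λ i a c → ∃ λ b → R i a b × S i b c) x z

module _ {n : ℕ} (B : BNF n) where
  open BNF B

  Fin-in : {α : Fin n → Set} → ((i : Fin n) → HSet (α i)) → F α → Set
  Fin-in A x = (i : Fin n) (a : _) → a ∈ₕ setF i x → a ∈ₕ A i

  Fin-in~ : (_∼_ : {α : Fin n → Set} → F α → F α → Set) →
            {α : Fin n → Set} → ((i : Fin n) → HSet (α i)) → F α → Set
  Fin-in~ _∼_ {α} A x =
    (f g : (i : Fin n) → α i → 1+ (α i)) →
    ((i : Fin n) (a : α i) → a ∈ₕ A i → f i a ≡ g i a) →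
    mapF f x ∼ mapF g x

[_]/ : {X : Set} → (X → X → Set) → X → (X → Set)
[ R ]/ x = λ y → R x y

_≐_ : {X : Set} → (X → Set) → (X → Set) → Set
P ≐ Q = ∀ y → P y ⇔ Q y

_∈Classes_/_ : {X : Set} → (X → Set) → (X → Set) → (X → X → Set) → Set
C ∈Classes S / R = ∃ λ x → S x × (C ≐ [ R ]/ x)

{-# OPTIONS --safe #-}
module Submission where

-- Pick a_i ∈ A_i and let r_i send elements of A_i to themselves and everything
-- else to a_i; this factors as α_i → 1 + α_i → α_i, marking non-members by ⊛.
-- Since the marking agrees with 𝔢 on A_i, membership of x in F^~_in A gives
-- map mark x ∼ map 𝔢 x; mapping back to α yields map r x ∼ x, and map r x lies
-- in F_in A because every r_i lands in A_i. So [x] = [map r x].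

open import Defs
open import Data.Nat using (ℕ)
open import Data.Fin using (Fin)
open import Data.Bool using (true; false; if_then_else_)
open import Data.Sum using ([_,_])
open import Data.Product using (∃; _,_; proj₁; proj₂)
open import Function using (_∘_; const; id)
open import Function.Bundles using (mk⇔; Equivalence)
open import Relation.Binary.PropositionalEquality using (_≡_; refl; trans; subst₂)
open import Relation.Binary.Structures using (IsEquivalence)

class-≐ : {X : Set} {R : X → X → Set} → IsEquivalence R →
          {x y : X} → R x y → [ R ]/ x ≐ [ R ]/ y
class-≐ eqv xRy z = mk⇔ (IsEquivalence.trans eqv (IsEquivalence.sym eqv xRy))
                         (IsEquivalence.trans eqv xRy)

≐-trans : {X : Set} {P Q S : X → Set} → P ≐ Q → Q ≐ S → P ≐ S
≐-trans P≐Q Q≐S z = mk⇔ (Equivalence.to (Q≐S z) ∘ Equivalence.to (P≐Q z))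
                        (Equivalence.from (P≐Q z) ∘ Equivalence.from (Q≐S z))

mark : {α : Set} → HSet α → α → 1+ α
mark A a = if A a then 𝔢 a else ⊛

mark-∈ : {α : Set} (A : HSet α) (a : α) → a ∈ₕ A → mark A a ≡ 𝔢 a
mark-∈ A a a∈A rewrite a∈A = refl

unmark : {α : Set} → α → 1+ α → α
unmark d = [ const d , id ]

clamp : {α : Set} → HSet α → α → α → α
clamp A d = unmark d ∘ mark A

clamp-∈ : {α : Set} (A : HSet α) {d : α} → d ∈ₕ A → (a : α) → clamp A d a ∈ₕ A
clamp-∈ A d∈A a with A a in a∈A
... | true  = a∈A
... | false = d∈A

module _ {n : ℕ} (B : BNF n) where
  open BNF B

  mapF-Fin-in : {α β : Fin n → Set} (A : (i : Fin n) → HSet (β i))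
                (g : (i : Fin n) → α i → β i) → ((i : Fin n) (a : α i) → g i a ∈ₕ A i) →
                (x : F α) → Fin-in B A (mapF g x)
  mapF-Fin-in A g g∈A x i b b∈set
    with Equivalence.to (set-map g x i b) b∈set
  ... | a , _ , refl = g∈A i a

  module _ (_∼_ : {α : Fin n → Set} → F α → F α → Set)
           (∼-mapF : {α β : Fin n → Set} (f : (i : Fin n) → α i → β i) (x y : F α) →
                     x ∼ y → mapF f x ∼ mapF f y)
           {α : Fin n → Set} (A : (i : Fin n) → HSet (α i)) (d : (i : Fin n) → α i) where

    Fin-in~⇒clamp∼ : (x : F α) → Fin-in~ B _∼_ A x → mapF (λ i → clamp (A i) (d i)) x ∼ x
    Fin-in~⇒clamp∼ x x∈~ =
      subst₂ _∼_ (map-comp marks unmarks x) (trans (map-comp (λ i → 𝔢) unmarks x) (map-id x))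
        (∼-mapF unmarks _ _ (x∈~ marks (λ i → 𝔢) (λ i → mark-∈ (A i))))
      where
      marks : (i : Fin n) → α i → 1+ (α i)
      marks i = mark (A i)
      unmarks : (i : Fin n) → 1+ (α i) → α i
      unmarks i = unmark (d i)

lemma3p3 : {n : ℕ} (B : BNF n) →
    (_∼_ : {α : Fin n → Set} → BNF.F B α → BNF.F B α → Set) →
    ({α : Fin n → Set} → IsEquivalence (_∼_ {α})) →
    ({α β : Fin n → Set} (f : (i : Fin n) → α i → β i) (x y : BNF.F B α) →
    x ∼ y → BNF.mapF B f x ∼ BNF.mapF B f y) →
    {α : Fin n → Set} (A : (i : Fin n) → HSet (α i)) →
    ((i : Fin n) → ∃ λ a → a ∈ₕ A i) →
    (C : BNF.F B α → Set) →
    C ∈Classes Fin-in~ B _∼_ A / _∼_ →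
    C ∈Classes Fin-in B A / _∼_
lemma3p3 {n} B _∼_ eqv ∼-mapF {α} A nonempty C (x , x∈~ , C≐[x]) =
  BNF.mapF B r x ,
  mapF-Fin-in B A r (λ i → clamp-∈ (A i) (proj₂ (nonempty i))) x ,
  ≐-trans C≐[x] (class-≐ eqv (IsEquivalence.sym eqv r[x]∼x))
  where
  a₀ : (i : Fin n) → α i
  a₀ i = proj₁ (nonempty i)
  r : (i : Fin n) → α i → α i
  r i = clamp (A i) (a₀ i)
  r[x]∼x : BNF.mapF B r x ∼ x
  r[x]∼x = Fin-in~⇒clamp∼ B _∼_ ∼-mapF A a₀ x x∈~
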